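{- Let $M_1,M_2$ be sparse paving matroids of rank $r$ on $E$, with $|E|\geq5$ and $2\leq r\leq|E|-2$. Then $$\nu_{M_1}\sim\nu_{M_2}\iff M_1=M_2.$$
   Context: A matroid of rank $r$ on $E$ is sparse paving if any two distinct non-bases $X,Y\in\binom{E}{r}$ satisfy $|X\setminus Y|\geq2$. For a matroid $N$ of rank $r$ on $E$ with rank function $r_N$, $\nu_N:\binom{E}{r}\to\mathbb{R}$ is $\nu_N(X):=r-r_N(X)$. $Z(r,E)$ is the set of triples $(S,ab,cd)$ with $S\in\binom{E}{r-2}$, $a,b,c,d\in E\setminus S$ distinct, $Sab:=S\cup\{a,b\}$ etc. For $\nu:\binom{E}{r}\to\mathbb{R}$, $[\nu]:=\{(S,ab,cd)\in Z(r,E):\nu(Sac)+\nu(Sbd)=\nu(Sad)+\nu(Sbc)\}$, and $\nu\sim\nu'$ means $[\nu]=[\nu']$. -}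

module Defs where

open import Data.Nat using (ℕ; zero; suc; _∸_; _⊔_; _≥_; _+_)
open import Data.Bool using (Bool; true; false; if_then_else_)
open import Data.Vec using (Vec; []; _∷_)
open import Data.List using (List; []; _∷_; map; _++_; foldr)
open import Data.Fin using (Fin)
open import Data.Fin.Subset using (Subset; _∩_; _∪_; _─_; _-_; ∣_∣; ⁅_⁆; _∈_; _∉_)
open import Data.Product using (Σ; _×_; ∃-syntax)
open import Relation.Binary.PropositionalEquality using (_≡_; _≢_)
open import Function.Bundles using (_⇔_)

allSubsets : (n : ℕ) → List (Subset n)
allSubsets zero = [] ∷ []
allSubsets (suc n) = map (true ∷_) (allSubsets n) ++ map (false ∷_) (allSubsets n)

record Matroid (n : ℕ) : Set where
  field
    isBasis   : Subset n → Bool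
    nonempty  : ∃[ B ] (isBasis B ≡ true)
    exchange  : ∀ B₁ B₂ → isBasis B₁ ≡ true → isBasis B₂ ≡ true →
                ∀ x → x ∈ B₁ → x ∉ B₂ →
                ∃[ y ] (y ∈ B₂ × y ∉ B₁ × isBasis ((B₁ - x) ∪ ⁅ y ⁆) ≡ true)
open Matroid public

HasRank : ∀ {n} → Matroid n → ℕ → Set
HasRank M r = ∀ B → isBasis M B ≡ true → ∣ B ∣ ≡ r

rankM : ∀ {n} → Matroid n → Subset n → ℕ
rankM {n} M X =
  foldr (λ B acc → if isBasis M B then ∣ X ∩ B ∣ ⊔ acc else acc) 0 (allSubsets n)

SparsePaving : ∀ {n} → Matroid n → ℕ → Set
SparsePaving {n} M r =
  ∀ (X Y : Subset n) → ∣ X ∣ ≡ r → ∣ Y ∣ ≡ r →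
  isBasis M X ≡ false → isBasis M Y ≡ false → X ≢ Y →
  ∣ X ─ Y ∣ ≥ 2

-- ν_M(X) = r − r_M(X)  (values are naturals since r_M(X) ≤ r).
ν : ∀ {n} → Matroid n → ℕ → Subset n → ℕ
ν M r X = r ∸ rankM M X

InZ : ∀ {n} → ℕ → Subset n → Fin n → Fin n → Fin n → Fin n → Set
InZ r S a b c d =
  ∣ S ∣ ≡ r ∸ 2 × a ∉ S × b ∉ S × c ∉ S × d ∉ S ×
  a ≢ b × a ≢ c × a ≢ d × b ≢ c × b ≢ d × c ≢ d

_⊕_,_ : ∀ {n} → Subset n → Fin n → Fin n → Subset n
S ⊕ x , y = (S ∪ ⁅ x ⁆) ∪ ⁅ y ⁆

InBracket : ∀ {n} → (Subset n → ℕ) → Subset n → Fin n → Fin n → Fin n → Fin n → Set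
InBracket f S a b c d = f (S ⊕ a , c) + f (S ⊕ b , d) ≡ f (S ⊕ a , d) + f (S ⊕ b , c)

_∼[_]_ : ∀ {n} → (Subset n → ℕ) → ℕ → (Subset n → ℕ) → Set
_∼[_]_ {n} f r g = ∀ (S : Subset n) (a b c d : Fin n) → InZ r S a b c d →
  (InBracket f S a b c d ⇔ InBracket g S a b c d)

SameMatroid : ∀ {n} → Matroid n → Matroid n → Set
SameMatroid {n} M₁ M₂ = ∀ (B : Subset n) → isBasis M₁ B ≡ isBasis M₂ B

-- Suppose B is a basis of M₂ but not of M₁. Write B = S ∪ {a, c} with b, d ∉ B chosen so
-- that S ∪ {b, d} is a basis of M₂; sparse paving allows this, after replacing c or d by a
-- third element if the first choice fails. In M₁ every r-set differing from the non-basis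
-- Sac in one element is a basis, so ν_{M₁} violates the exchange equation at (S, ab, cd) and
-- at (S, ad, cb). In M₂ the sets Sac, Sbd are bases, and either Sad, Sbc are bases too, or
-- one of them is not and then its neighbours Sab, Sdc are; so ν_{M₂} satisfies one of the two
-- equations, and [ν_{M₁}] ≠ [ν_{M₂}].
module Submission where

open import Defs
open import Data.Nat using (ℕ; _≥_; _≤_; _∸_)
open import Function.Bundles using (_⇔_)

open import Data.Nat using (zero; suc; _+_; _⊔_; _<_; z≤n; s≤s; s≤s⁻¹; _≤?_)
open import Data.Nat.Properties
  using (≤-trans; ≤-antisym; ≤∧≢⇒<; suc-injective; 1+n≰n; n≮0; >⇒≢; ≰⇒>; m≤m⊔n; m≤n⊔m;
         ⊔-lub; m<n⇒0<n∸m; m≤n⇒m∸n≡0; m+n≡0⇒m≡0; m+n≤o⇒m≤o∸n; m≤o∸n⇒m+n≤o; +-comm; +-monoʳ-≤)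
open import Data.Bool using (Bool; true; false; if_then_else_)
open import Data.Vec using ([]; _∷_; here; there)
open import Data.List using ([]; _∷_; map; foldr)
import Data.List.Relation.Unary.Any as Any
open import Data.List.Membership.Propositional using () renaming (_∈_ to _∈ₗ_)
open import Data.List.Membership.Propositional.Properties using (∈-map⁺; ∈-++⁺ˡ; ∈-++⁺ʳ)
open import Data.Fin using (Fin; zero; suc; _≟_)
open import Data.Fin.Subset using (Subset; _∩_; _∪_; _─_; _-_; ∣_∣; ⁅_⁆; _∈_; _∉_; _⊆_; ∁; Nonempty)
open import Data.Fin.Subset.Properties
  using (x∈⁅x⁆; x∈⁅y⁆⇒x≡y; x∉⁅y⁆⇒x≢y; ∣⁅x⁆∣≡1; p⊆q⇒∣p∣≤∣q∣; drop-∷-⊆; ⊆-antisym; x∈p∪q⁻; x∈p∪q⁺;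
         ∪-assoc; ∪-comm; ∪-identityʳ; ∩-idem; p∩q⊆p; p∩q⊆q; ∣p∩q∣≤∣p∣; p─⊥≡p; x∈p∧x≢y⇒x∈p-y;
         ∣∁p∣≡n∸∣p∣; x∈∁p⇒x∉p)
open import Data.Product using (_×_; _,_; ∃-syntax)
open import Data.Sum using (_⊎_; inj₁; inj₂)
open import Data.Empty using (⊥; ⊥-elim)
open import Function.Base using (_∘_)
open import Relation.Nullary using (¬_; yes; no; contradiction)
open import Relation.Binary.PropositionalEquality
  using (_≡_; _≢_; _≗_; refl; sym; trans; cong; cong₂; subst; ≢-sym; module ≡-Reasoning)
open import Function.Bundles using (mk⇔; Equivalence)

private
  variable
    n r : ℕ
    M M₁ M₂ : Matroid n
    p q S X B : Subset n
    i a b c d e w x y y′ : Fin n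
    f g : Subset n → ℕ

-- Finite subsets

x∈p─q⁻ : i ∈ p ─ q → i ∈ p × i ∉ q
x∈p─q⁻ {p = true ∷ p} {q = false ∷ q} here = here , λ ()
x∈p─q⁻ {i = zero} {p = _ ∷ p} {q = true ∷ q} ()
x∈p─q⁻ {i = zero} {p = false ∷ p} {q = false ∷ q} ()
x∈p─q⁻ {p = _ ∷ p} {q = _ ∷ q} (there i∈p─q) with x∈p─q⁻ i∈p─q
... | i∈p , i∉q = there i∈p , λ { (there i∈q) → i∉q i∈q }

∣p∪⁅x⁆∣ : x ∉ p → ∣ p ∪ ⁅ x ⁆ ∣ ≡ suc ∣ p ∣
∣p∪⁅x⁆∣ {x = zero}  {p = true ∷ p}  x∉p = contradiction here x∉p
∣p∪⁅x⁆∣ {x = zero}  {p = false ∷ p} x∉p = cong (suc ∘ ∣_∣) (∪-identityʳ p)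
∣p∪⁅x⁆∣ {x = suc x} {p = true ∷ p}  x∉p = cong suc (∣p∪⁅x⁆∣ (x∉p ∘ there))
∣p∪⁅x⁆∣ {x = suc x} {p = false ∷ p} x∉p = ∣p∪⁅x⁆∣ (x∉p ∘ there)

∣p-x∣ : x ∈ p → suc ∣ p - x ∣ ≡ ∣ p ∣
∣p-x∣ {x = zero}  {p = true ∷ p}  here        = cong (suc ∘ ∣_∣) (p─⊥≡p p)
∣p-x∣ {x = suc x} {p = true ∷ p}  (there x∈p) = cong suc (∣p-x∣ x∈p)
∣p-x∣ {x = suc x} {p = false ∷ p} (there x∈p) = ∣p-x∣ x∈p

∣p∣>0⇒Nonempty : 0 < ∣ p ∣ → Nonempty p
∣p∣>0⇒Nonempty {p = true ∷ p}  _     = zero , here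
∣p∣>0⇒Nonempty {p = false ∷ p} ∣p∣>0 with ∣p∣>0⇒Nonempty ∣p∣>0
... | x , x∈p = suc x , there x∈p

p⊆q∧∣p∣≡∣q∣⇒p≡q : p ⊆ q → ∣ p ∣ ≡ ∣ q ∣ → p ≡ q
p⊆q∧∣p∣≡∣q∣⇒p≡q {p = []}        {q = []}        _   _ = refl
p⊆q∧∣p∣≡∣q∣⇒p≡q {p = true ∷ p}  {q = true ∷ q}  p⊆q e =
  cong (true ∷_) (p⊆q∧∣p∣≡∣q∣⇒p≡q (drop-∷-⊆ p⊆q) (suc-injective e))
p⊆q∧∣p∣≡∣q∣⇒p≡q {p = false ∷ p} {q = false ∷ q} p⊆q e =
  cong (false ∷_) (p⊆q∧∣p∣≡∣q∣⇒p≡q (drop-∷-⊆ p⊆q) e)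
p⊆q∧∣p∣≡∣q∣⇒p≡q {p = true ∷ p}  {q = false ∷ q} p⊆q _ with p⊆q here
... | ()
p⊆q∧∣p∣≡∣q∣⇒p≡q {p = false ∷ p} {q = true ∷ q}  p⊆q e =
  contradiction (subst (_≤ ∣ q ∣) e (p⊆q⇒∣p∣≤∣q∣ (drop-∷-⊆ p⊆q))) 1+n≰n

twoElements : 2 ≤ ∣ p ∣ → ∃[ x ] ∃[ y ] (x ∈ p × y ∈ p × x ≢ y)
twoElements {p = p} 2≤∣p∣ with ∣p∣>0⇒Nonempty (≤-trans (s≤s z≤n) 2≤∣p∣)
... | x , x∈p with ∣p∣>0⇒Nonempty (s≤s⁻¹ (subst (2 ≤_) (sym (∣p-x∣ x∈p)) 2≤∣p∣))
... | y , y∈p-x with x∈p─q⁻ y∈p-x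
... | y∈p , y∉⁅x⁆ = x , y , x∈p , y∈p , ≢-sym (x∉⁅y⁆⇒x≢y y∉⁅x⁆)

∈p-x-y⁻ : i ∈ p - x - y → i ∈ p × i ≢ x × i ≢ y
∈p-x-y⁻ i∈ with x∈p─q⁻ i∈
... | i∈p-x , i∉⁅y⁆ with x∈p─q⁻ i∈p-x
... | i∈p , i∉⁅x⁆ = i∈p , x∉⁅y⁆⇒x≢y i∉⁅x⁆ , x∉⁅y⁆⇒x≢y i∉⁅y⁆

∈p-x-y⁺ : i ∈ p → i ≢ x → i ≢ y → i ∈ p - x - y
∈p-x-y⁺ i∈p i≢x i≢y = x∈p∧x≢y⇒x∈p-y (x∈p∧x≢y⇒x∈p-y i∈p i≢x) i≢y

∣p-x-y∣ : x ∈ p → y ∈ p → x ≢ y → 2 + ∣ p - x - y ∣ ≡ ∣ p ∣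
∣p-x-y∣ x∈p y∈p x≢y = trans (cong suc (∣p-x∣ (x∈p∧x≢y⇒x∈p-y y∈p (≢-sym x≢y)))) (∣p-x∣ x∈p)

thirdElement : 3 ≤ ∣ p ∣ → x ∈ p → y ∈ p → x ≢ y → ∃[ z ] (z ∈ p × z ≢ x × z ≢ y)
thirdElement 3≤∣p∣ x∈p y∈p x≢y
  with ∣p∣>0⇒Nonempty (s≤s⁻¹ (s≤s⁻¹ (subst (3 ≤_) (sym (∣p-x-y∣ x∈p y∈p x≢y)) 3≤∣p∣)))
... | z , z∈ = z , ∈p-x-y⁻ z∈

∈-⊕⁻ : i ∈ S ⊕ x , y → i ∈ S ⊎ i ≡ x ⊎ i ≡ y
∈-⊕⁻ {S = S} {x = x} {y = y} i∈ with x∈p∪q⁻ (S ∪ ⁅ x ⁆) ⁅ y ⁆ i∈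
... | inj₂ i∈⁅y⁆ = inj₂ (inj₂ (x∈⁅y⁆⇒x≡y y i∈⁅y⁆))
... | inj₁ i∈S∪⁅x⁆ with x∈p∪q⁻ S ⁅ x ⁆ i∈S∪⁅x⁆
...   | inj₁ i∈S    = inj₁ i∈S
...   | inj₂ i∈⁅x⁆ = inj₂ (inj₁ (x∈⁅y⁆⇒x≡y x i∈⁅x⁆))

S⊆S⊕x,y : S ⊆ S ⊕ x , y
S⊆S⊕x,y i∈S = x∈p∪q⁺ (inj₁ (x∈p∪q⁺ (inj₁ i∈S)))

x∈S⊕x,y : x ∈ S ⊕ x , y
x∈S⊕x,y {x = x} = x∈p∪q⁺ (inj₁ (x∈p∪q⁺ (inj₂ (x∈⁅x⁆ x))))

y∈S⊕x,y : y ∈ S ⊕ x , y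
y∈S⊕x,y {y = y} = x∈p∪q⁺ (inj₂ (x∈⁅x⁆ y))

∉-⊕⁺ : i ∉ S → i ≢ x → i ≢ y → i ∉ S ⊕ x , y
∉-⊕⁺ i∉S i≢x i≢y i∈ with ∈-⊕⁻ i∈
... | inj₁ i∈S        = i∉S i∈S
... | inj₂ (inj₁ i≡x) = i≢x i≡x
... | inj₂ (inj₂ i≡y) = i≢y i≡y

⊕-comm : ∀ (S : Subset n) x y → S ⊕ x , y ≡ S ⊕ y , x
⊕-comm S x y = begin
  (S ∪ ⁅ x ⁆) ∪ ⁅ y ⁆   ≡⟨ ∪-assoc S ⁅ x ⁆ ⁅ y ⁆ ⟩
  S ∪ (⁅ x ⁆ ∪ ⁅ y ⁆)   ≡⟨ cong (S ∪_) (∪-comm ⁅ x ⁆ ⁅ y ⁆) ⟩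
  S ∪ (⁅ y ⁆ ∪ ⁅ x ⁆)   ≡⟨ ∪-assoc S ⁅ y ⁆ ⁅ x ⁆ ⟨
  (S ∪ ⁅ y ⁆) ∪ ⁅ x ⁆   ∎
  where open ≡-Reasoning

∣S⊕x,y∣ : 2 ≤ r → ∣ S ∣ ≡ r ∸ 2 → x ∉ S → y ∉ S → x ≢ y → ∣ S ⊕ x , y ∣ ≡ r
∣S⊕x,y∣ {r = suc (suc r)} {S = S} {x = x} {y = y} (s≤s (s≤s z≤n)) ∣S∣ x∉S y∉S x≢y =
  trans (∣p∪⁅x⁆∣ y∉S∪⁅x⁆) (cong suc (trans (∣p∪⁅x⁆∣ x∉S) (cong suc ∣S∣)))
  where
  y∉S∪⁅x⁆ : y ∉ S ∪ ⁅ x ⁆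
  y∉S∪⁅x⁆ y∈ with x∈p∪q⁻ S ⁅ x ⁆ y∈
  ... | inj₁ y∈S    = y∉S y∈S
  ... | inj₂ y∈⁅x⁆ = x≢y (sym (x∈⁅y⁆⇒x≡y x y∈⁅x⁆))

p-x-y⊕x,y≡p : x ∈ p → y ∈ p → (p - x - y) ⊕ x , y ≡ p
p-x-y⊕x,y≡p {x = x} {p = p} {y = y} x∈p y∈p = ⊆-antisym ⊆p p⊆
  where
  ⊆p : (p - x - y) ⊕ x , y ⊆ p
  ⊆p i∈ with ∈-⊕⁻ i∈
  ... | inj₁ i∈S         = let i∈p , _ = ∈p-x-y⁻ i∈S in i∈p
  ... | inj₂ (inj₁ refl) = x∈p
  ... | inj₂ (inj₂ refl) = y∈p
  p⊆ : p ⊆ (p - x - y) ⊕ x , y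
  p⊆ {i} i∈p with i ≟ x | i ≟ y
  ... | yes refl | _        = x∈S⊕x,y
  ... | no _     | yes refl = y∈S⊕x,y
  ... | no i≢x   | no i≢y   = S⊆S⊕x,y (∈p-x-y⁺ i∈p i≢x i≢y)

isBasis-⊕-comm : ∀ (M : Matroid n) S x y → isBasis M (S ⊕ x , y) ≡ isBasis M (S ⊕ y , x)
isBasis-⊕-comm M S x y = cong (isBasis M) (⊕-comm S x y)

-- The rank function

∈-allSubsets : ∀ (p : Subset n) → p ∈ₗ allSubsets n
∈-allSubsets []          = Any.here refl
∈-allSubsets (true ∷ p)  = ∈-++⁺ˡ (∈-map⁺ (true ∷_) (∈-allSubsets p))
∈-allSubsets (false ∷ p) = ∈-++⁺ʳ (map (true ∷_) (allSubsets _)) (∈-map⁺ (false ∷_) (∈-allSubsets p))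

module _ (M : Matroid n) (X : Subset n) where

  private
    maxStep : Subset n → ℕ → ℕ
    maxStep B acc = if isBasis M B then ∣ X ∩ B ∣ ⊔ acc else acc

  ∣X∩B∣≤rankM : isBasis M B ≡ true → ∣ X ∩ B ∣ ≤ rankM M X
  ∣X∩B∣≤rankM {B = B} isB = go (allSubsets n) (∈-allSubsets B)
    where
    go : ∀ Bs → B ∈ₗ Bs → ∣ X ∩ B ∣ ≤ foldr maxStep 0 Bs
    go (_ ∷ Bs) (Any.here refl) rewrite isB = m≤m⊔n _ _
    go (C ∷ Bs) (Any.there B∈Bs) with isBasis M C
    ... | true  = ≤-trans (go Bs B∈Bs) (m≤n⊔m _ _)
    ... | false = go Bs B∈Bs

  rankM≤ : ∀ {k} → (∀ B → isBasis M B ≡ true → ∣ X ∩ B ∣ ≤ k) → rankM M X ≤ k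
  rankM≤ {k} bound = go (allSubsets n)
    where
    go : ∀ Bs → foldr maxStep 0 Bs ≤ k
    go []       = z≤n
    go (B ∷ Bs) with isBasis M B in isB
    ... | true  = ⊔-lub (bound B isB) (go Bs)
    ... | false = go Bs

rankM-cong : ∀ (M₁ M₂ : Matroid n) → SameMatroid M₁ M₂ → ∀ X → rankM M₁ X ≡ rankM M₂ X
rankM-cong M₁ M₂ same X = ≤-antisym
  (rankM≤ M₁ X λ B isB → ∣X∩B∣≤rankM M₂ X (trans (sym (same B)) isB))
  (rankM≤ M₂ X λ B isB → ∣X∩B∣≤rankM M₁ X (trans (same B) isB))

∣X∩B∣<r : ∀ (M : Matroid n) → HasRank M r → ∣ X ∣ ≡ r → isBasis M X ≡ false →
          isBasis M B ≡ true → ∣ X ∩ B ∣ < r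
∣X∩B∣<r {r = r} {X = X} {B = B} M hasRank ∣X∣ isX isB =
  ≤∧≢⇒< (subst (∣ X ∩ B ∣ ≤_) ∣X∣ (∣p∩q∣≤∣p∣ X B)) ∣X∩B∣≢r
  where
  ∣X∩B∣≢r : ∣ X ∩ B ∣ ≢ r
  ∣X∩B∣≢r e with trans (sym (p⊆q∧∣p∣≡∣q∣⇒p≡q (p∩q⊆p X B) (trans e (sym ∣X∣))))
                       (p⊆q∧∣p∣≡∣q∣⇒p≡q (p∩q⊆q X B) (trans e (sym (hasRank B isB))))
  ... | refl with trans (sym isX) isB
  ...   | ()

rankM<r : ∀ (M : Matroid n) → HasRank M r → ∣ X ∣ ≡ r → isBasis M X ≡ false → rankM M X < r
rankM<r {r = zero} M hasRank ∣X∣ isX =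
  let B , isB = nonempty M in contradiction (∣X∩B∣<r M hasRank ∣X∣ isX isB) n≮0
rankM<r {r = suc r} {X = X} M hasRank ∣X∣ isX =
  s≤s (rankM≤ M X λ B isB → s≤s⁻¹ (∣X∩B∣<r M hasRank ∣X∣ isX isB))

ν-basis : ∀ (M : Matroid n) → HasRank M r → isBasis M X ≡ true → ν M r X ≡ 0
ν-basis {r = r} {X = X} M hasRank isX =
  m≤n⇒m∸n≡0 (subst (_≤ rankM M X) ∣X∩X∣≡r (∣X∩B∣≤rankM M X isX))
  where
  ∣X∩X∣≡r : ∣ X ∩ X ∣ ≡ r
  ∣X∩X∣≡r = trans (cong ∣_∣ (∩-idem X)) (hasRank X isX)

ν-nonBasis : ∀ (M : Matroid n) → HasRank M r → ∣ X ∣ ≡ r → isBasis M X ≡ false → 0 < ν M r X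
ν-nonBasis M hasRank ∣X∣ isX = m<n⇒0<n∸m (rankM<r M hasRank ∣X∣ isX)

ν-cong : ∀ (M₁ M₂ : Matroid n) → SameMatroid M₁ M₂ → ν M₁ r ≗ ν M₂ r
ν-cong {r = r} M₁ M₂ same X = cong (r ∸_) (rankM-cong M₁ M₂ same X)

-- Sparse paving matroids

nonBasis-neighbour-isBasis : ∀ (M : Matroid n) → SparsePaving M r → ∣ p ∣ ≡ r → ∣ q ∣ ≡ r →
                             isBasis M p ≡ false → w ∈ p → w ∉ q → (∀ {i} → i ∈ p → i ∉ q → i ≡ w) →
                             isBasis M q ≡ true
nonBasis-neighbour-isBasis {p = p} {q = q} {w = w} M sp ∣p∣ ∣q∣ isp w∈p w∉q p─q⊆w
  with isBasis M q in isq
... | true  = refl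
... | false = contradiction (≤-trans (sp p q ∣p∣ ∣q∣ isp isq p≢q) ∣p─q∣≤1) 1+n≰n
  where
  p≢q : p ≢ q
  p≢q refl = w∉q w∈p
  ∣p─q∣≤1 : ∣ p ─ q ∣ ≤ 1
  ∣p─q∣≤1 = subst (∣ p ─ q ∣ ≤_) (∣⁅x⁆∣≡1 w) (p⊆q⇒∣p∣≤∣q∣ λ i∈ →
    let i∈p , i∉q = x∈p─q⁻ i∈ in subst (_∈ ⁅ w ⁆) (sym (p─q⊆w i∈p i∉q)) (x∈⁅x⁆ w))

nonBasis-swapʳ : ∀ (M : Matroid n) → SparsePaving M r → 2 ≤ r → ∣ S ∣ ≡ r ∸ 2 →
                 x ∉ S → y ∉ S → y′ ∉ S → x ≢ y → x ≢ y′ → y ≢ y′ →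
                 isBasis M (S ⊕ x , y) ≡ false → isBasis M (S ⊕ x , y′) ≡ true
nonBasis-swapʳ {S = S} {x = x} {y = y} {y′ = y′} M sp 2≤r ∣S∣ x∉S y∉S y′∉S x≢y x≢y′ y≢y′ isxy =
  nonBasis-neighbour-isBasis M sp (∣S⊕x,y∣ 2≤r ∣S∣ x∉S y∉S x≢y) (∣S⊕x,y∣ 2≤r ∣S∣ x∉S y′∉S x≢y′) isxy
    y∈S⊕x,y (∉-⊕⁺ y∉S (≢-sym x≢y) y≢y′) onlyY
  where
  onlyY : ∀ {i} → i ∈ S ⊕ x , y → i ∉ S ⊕ x , y′ → i ≡ y
  onlyY i∈ i∉ with ∈-⊕⁻ i∈
  ... | inj₁ i∈S         = contradiction (S⊆S⊕x,y i∈S) i∉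
  ... | inj₂ (inj₁ refl) = contradiction x∈S⊕x,y i∉
  ... | inj₂ (inj₂ i≡y)  = i≡y

nonBasis-swapˡ : ∀ (M : Matroid n) → SparsePaving M r → 2 ≤ r → ∣ S ∣ ≡ r ∸ 2 →
                 x ∉ S → y′ ∉ S → y ∉ S → x ≢ y → y′ ≢ y → x ≢ y′ →
                 isBasis M (S ⊕ x , y) ≡ false → isBasis M (S ⊕ y′ , y) ≡ true
nonBasis-swapˡ {S = S} {x = x} {y′ = y′} {y = y}
  M sp 2≤r ∣S∣ x∉S y′∉S y∉S x≢y y′≢y x≢y′ isxy =
  trans (isBasis-⊕-comm M S y′ y)
    (nonBasis-swapʳ M sp 2≤r ∣S∣ y∉S x∉S y′∉S (≢-sym x≢y) (≢-sym y′≢y) x≢y′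
      (trans (isBasis-⊕-comm M S y x) isxy))

∈∧∉⇒≢ : x ∈ p → y ∉ p → x ≢ y
∈∧∉⇒≢ {p = p} x∈p y∉p refl = y∉p x∈p

x∉p-x-y : x ∉ p - x - y
x∉p-x-y x∈ = let _ , x≢x , _ = ∈p-x-y⁻ x∈ in x≢x refl

y∉p-x-y : y ∉ p - x - y
y∉p-x-y y∈ = let _ , _ , y≢y = ∈p-x-y⁻ y∈ in y≢y refl

∉p⇒∉p-x-y : i ∉ p → i ∉ p - x - y
∉p⇒∉p-x-y i∉p i∈ = let i∈p , _ = ∈p-x-y⁻ i∈ in i∉p i∈p

∣p-x-y∣≡r∸2 : ∣ p ∣ ≡ r → x ∈ p → y ∈ p → x ≢ y → ∣ p - x - y ∣ ≡ r ∸ 2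
∣p-x-y∣≡r∸2 ∣p∣ x∈p y∈p x≢y = cong (_∸ 2) (trans (∣p-x-y∣ x∈p y∈p x≢y) ∣p∣)

InZ-split : ∣ B ∣ ≡ r → a ∈ B → c ∈ B → a ≢ c → b ∉ B → d ∉ B → b ≢ d → InZ r (B - a - c) a b c d
InZ-split ∣B∣ a∈B c∈B a≢c b∉B d∉B b≢d =
  ∣p-x-y∣≡r∸2 ∣B∣ a∈B c∈B a≢c , x∉p-x-y , ∉p⇒∉p-x-y b∉B , y∉p-x-y , ∉p⇒∉p-x-y d∉B ,
  ∈∧∉⇒≢ a∈B b∉B , a≢c , ∈∧∉⇒≢ a∈B d∉B , ≢-sym (∈∧∉⇒≢ c∈B b∉B) , b≢d , ∈∧∉⇒≢ c∈B d∉B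

-- Exchange equations

_⊑[_]_ : (Subset n → ℕ) → ℕ → (Subset n → ℕ) → Set
f ⊑[ r ] g = ∀ S a b c d → InZ r S a b c d → InBracket f S a b c d → InBracket g S a b c d

InBracket-≗ : f ≗ g → InBracket f S a b c d → InBracket g S a b c d
InBracket-≗ f≗g br =
  trans (cong₂ _+_ (sym (f≗g _)) (sym (f≗g _))) (trans br (cong₂ _+_ (f≗g _) (f≗g _)))

≗⇒∼ : f ≗ g → f ∼[ r ] g
≗⇒∼ f≗g S a b c d _ = mk⇔ (InBracket-≗ f≗g) (InBracket-≗ (sym ∘ f≗g))

InBracket-bases : ∀ (M : Matroid n) → HasRank M r →
                  isBasis M (S ⊕ a , c) ≡ true → isBasis M (S ⊕ b , d) ≡ true →
                  isBasis M (S ⊕ a , d) ≡ true → isBasis M (S ⊕ b , c) ≡ true →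
                  InBracket (ν M r) S a b c d
InBracket-bases M hasRank ac bd ad bc =
  trans (cong₂ _+_ (ν-basis M hasRank ac) (ν-basis M hasRank bd))
        (sym (cong₂ _+_ (ν-basis M hasRank ad) (ν-basis M hasRank bc)))

¬InBracket-nonBasis : ∀ (M : Matroid n) → HasRank M r → ∣ S ⊕ a , c ∣ ≡ r →
                      isBasis M (S ⊕ a , c) ≡ false →
                      isBasis M (S ⊕ a , d) ≡ true → isBasis M (S ⊕ b , c) ≡ true →
                      ¬ InBracket (ν M r) S a b c d
¬InBracket-nonBasis M hasRank ∣Sac∣ ac ad bc br =
  >⇒≢ (ν-nonBasis M hasRank ∣Sac∣ ac)
      (m+n≡0⇒m≡0 _ (trans br (cong₂ _+_ (ν-basis M hasRank ad) (ν-basis M hasRank bc))))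

⊑-excludes-frame : ∀ (M₁ M₂ : Matroid n) → 2 ≤ r → HasRank M₁ r → HasRank M₂ r →
                   SparsePaving M₁ r → SparsePaving M₂ r → ν M₂ r ⊑[ r ] ν M₁ r →
                   InZ r S a b c d → isBasis M₁ (S ⊕ a , c) ≡ false →
                   isBasis M₂ (S ⊕ a , c) ≡ true → isBasis M₂ (S ⊕ b , d) ≡ true → ⊥
⊑-excludes-frame {r = r} {S = S} {a = a} {b = b} {c = c} {d = d} M₁ M₂ 2≤r hr₁ hr₂ sp₁ sp₂ ⊑
  z@(∣S∣ , a∉ , b∉ , c∉ , d∉ , a≢b , a≢c , a≢d , b≢c , b≢d , c≢d) ac₁ ac₂ bd₂ = cases
  where
  ∣Sac∣ : ∣ S ⊕ a , c ∣ ≡ r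
  ∣Sac∣ = ∣S⊕x,y∣ 2≤r ∣S∣ a∉ c∉ a≢c

  parallel : isBasis M₂ (S ⊕ a , d) ≡ true → isBasis M₂ (S ⊕ b , c) ≡ true → ⊥
  parallel ad₂ bc₂ = ¬InBracket-nonBasis M₁ hr₁ ∣Sac∣ ac₁ ad₁ bc₁
    (⊑ S a b c d z (InBracket-bases M₂ hr₂ ac₂ bd₂ ad₂ bc₂))
    where
    ad₁ : isBasis M₁ (S ⊕ a , d) ≡ true
    ad₁ = nonBasis-swapʳ M₁ sp₁ 2≤r ∣S∣ a∉ c∉ d∉ a≢c a≢d c≢d ac₁
    bc₁ : isBasis M₁ (S ⊕ b , c) ≡ true
    bc₁ = nonBasis-swapˡ M₁ sp₁ 2≤r ∣S∣ a∉ b∉ c∉ a≢c b≢c a≢b ac₁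

  crossed : isBasis M₂ (S ⊕ a , b) ≡ true → isBasis M₂ (S ⊕ d , c) ≡ true → ⊥
  crossed ab₂ dc₂ = ¬InBracket-nonBasis M₁ hr₁ ∣Sac∣ ac₁ ab₁ dc₁
    (⊑ S a d c b z′ (InBracket-bases M₂ hr₂ ac₂ (trans (isBasis-⊕-comm M₂ S d b) bd₂) ab₂ dc₂))
    where
    z′ : InZ r S a d c b
    z′ = ∣S∣ , a∉ , d∉ , c∉ , b∉ , a≢d , a≢c , a≢b , ≢-sym c≢d , ≢-sym b≢d , ≢-sym b≢c
    ab₁ : isBasis M₁ (S ⊕ a , b) ≡ true
    ab₁ = nonBasis-swapʳ M₁ sp₁ 2≤r ∣S∣ a∉ c∉ b∉ a≢c a≢b (≢-sym b≢c) ac₁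
    dc₁ : isBasis M₁ (S ⊕ d , c) ≡ true
    dc₁ = nonBasis-swapˡ M₁ sp₁ 2≤r ∣S∣ a∉ d∉ c∉ a≢c (≢-sym c≢d) a≢d ac₁

  cases : ⊥
  cases with isBasis M₂ (S ⊕ a , d) in ad₂ | isBasis M₂ (S ⊕ b , c) in bc₂
  ... | true  | true  = parallel ad₂ bc₂
  ... | false | _     =
    crossed (nonBasis-swapʳ M₂ sp₂ 2≤r ∣S∣ a∉ d∉ b∉ a≢d a≢b (≢-sym b≢d) ad₂)
            (trans (isBasis-⊕-comm M₂ S d c) (nonBasis-swapˡ M₂ sp₂ 2≤r ∣S∣ a∉ c∉ d∉ a≢d c≢d a≢c ad₂))
  ... | true  | false =
    crossed (trans (isBasis-⊕-comm M₂ S a b)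
                   (nonBasis-swapʳ M₂ sp₂ 2≤r ∣S∣ b∉ c∉ a∉ b≢c (≢-sym a≢b) (≢-sym a≢c) bc₂))
            (nonBasis-swapˡ M₂ sp₂ 2≤r ∣S∣ b∉ d∉ c∉ b≢c (≢-sym c≢d) b≢d bc₂)

-- Finding a frame around a basis

m≤o∸n⇒n≤o∸m : ∀ {m n o} → n ≤ o → m ≤ o ∸ n → n ≤ o ∸ m
m≤o∸n⇒n≤o∸m {m} {n} {o} n≤o m≤o∸n =
  m+n≤o⇒m≤o∸n n (subst (_≤ o) (+-comm m n) (m≤o∸n⇒m+n≤o m n≤o m≤o∸n))

∣∁p∣≡n∸r : ∀ {n r} {p : Subset n} → ∣ p ∣ ≡ r → ∣ ∁ p ∣ ≡ n ∸ r
∣∁p∣≡n∸r {n} {p = p} ∣p∣ = trans (∣∁p∣≡n∸∣p∣ p) (cong (n ∸_) ∣p∣)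

Frame : Matroid n → ℕ → Subset n → Set
Frame M r B =
  ∃[ S ] ∃[ a ] ∃[ b ] ∃[ c ] ∃[ d ] (InZ r S a b c d × S ⊕ a , c ≡ B × isBasis M (S ⊕ b , d) ≡ true)

frame-split : ∀ (M : Matroid n) → ∣ B ∣ ≡ r → a ∈ B → c ∈ B → a ≢ c → b ∉ B → d ∉ B → b ≢ d →
              isBasis M ((B - a - c) ⊕ b , d) ≡ true → Frame M r B
frame-split {B = B} {a = a} {c = c} {b = b} {d = d} M ∣B∣ a∈B c∈B a≢c b∉B d∉B b≢d bd =
  B - a - c , a , b , c , d , InZ-split ∣B∣ a∈B c∈B a≢c b∉B d∉B b≢d , p-x-y⊕x,y≡p a∈B c∈B , bd

nonBasis-swap-inside : ∀ (M : Matroid n) → SparsePaving M r → 2 ≤ r → ∣ B ∣ ≡ r →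
                       a ∈ B → c ∈ B → e ∈ B → a ≢ c → a ≢ e → c ≢ e →
                       b ∉ B → d ∉ B → b ≢ d →
                       isBasis M ((B - a - c) ⊕ b , d) ≡ false → isBasis M ((B - a - e) ⊕ b , d) ≡ true
nonBasis-swap-inside {B = B} {a = a} {c = c} {e = e} {b = b} {d = d}
  M sp 2≤r ∣B∣ a∈B c∈B e∈B a≢c a≢e c≢e b∉B d∉B b≢d isac =
  nonBasis-neighbour-isBasis M sp (∣B-x-y⊕b,d∣ c∈B a≢c) (∣B-x-y⊕b,d∣ e∈B a≢e) isac
    (S⊆S⊕x,y (∈p-x-y⁺ e∈B (≢-sym a≢e) (≢-sym c≢e)))
    (∉-⊕⁺ y∉p-x-y (∈∧∉⇒≢ e∈B b∉B) (∈∧∉⇒≢ e∈B d∉B)) onlyE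
  where
  ∣B-x-y⊕b,d∣ : ∀ {y} → y ∈ B → a ≢ y → ∣ (B - a - y) ⊕ b , d ∣ ≡ _
  ∣B-x-y⊕b,d∣ y∈B a≢y =
    ∣S⊕x,y∣ 2≤r (∣p-x-y∣≡r∸2 ∣B∣ a∈B y∈B a≢y) (∉p⇒∉p-x-y b∉B) (∉p⇒∉p-x-y d∉B) b≢d
  onlyE : ∀ {i} → i ∈ (B - a - c) ⊕ b , d → i ∉ (B - a - e) ⊕ b , d → i ≡ e
  onlyE {i} i∈ i∉ with ∈-⊕⁻ i∈
  ... | inj₂ (inj₁ refl) = contradiction x∈S⊕x,y i∉
  ... | inj₂ (inj₂ refl) = contradiction y∈S⊕x,y i∉
  ... | inj₁ i∈S with i ≟ e
  ...   | yes i≡e = i≡e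
  ...   | no i≢e  = let i∈B , i≢a , _ = ∈p-x-y⁻ i∈S in
                    contradiction (S⊆S⊕x,y (∈p-x-y⁺ i∈B i≢a i≢e)) i∉

-- If Sbd is not a basis, c is replaced by a third element of B or, when r = 2, d by a
-- third element outside B, which exists because n ≥ 5.
frame : ∀ (M : Matroid n) → n ≥ 5 → 2 ≤ r → r ≤ n ∸ 2 → SparsePaving M r → ∣ B ∣ ≡ r → Frame M r B
frame {n = n} {r = r} {B = B} M 5≤n 2≤r r≤n∸2 sp ∣B∣
  with twoElements (subst (2 ≤_) (sym ∣B∣) 2≤r)
     | twoElements (subst (2 ≤_) (sym (∣∁p∣≡n∸r {p = B} ∣B∣))
                          (m≤o∸n⇒n≤o∸m (≤-trans (s≤s (s≤s z≤n)) 5≤n) r≤n∸2))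
... | a , c , a∈B , c∈B , a≢c | b , d , b∈∁B , d∈∁B , b≢d
  with isBasis M ((B - a - c) ⊕ b , d) in bd
... | true  = frame-split M ∣B∣ a∈B c∈B a≢c (x∈∁p⇒x∉p b∈∁B) (x∈∁p⇒x∉p d∈∁B) b≢d bd
... | false with 3 ≤? r
...   | yes 3≤r =
  let e , e∈B , e≢a , e≢c = thirdElement (subst (3 ≤_) (sym ∣B∣) 3≤r) a∈B c∈B a≢c in
  frame-split M ∣B∣ a∈B e∈B (≢-sym e≢a) (x∈∁p⇒x∉p b∈∁B) (x∈∁p⇒x∉p d∈∁B) b≢d
    (nonBasis-swap-inside M sp 2≤r ∣B∣ a∈B c∈B e∈B a≢c (≢-sym e≢a) (≢-sym e≢c)
      (x∈∁p⇒x∉p b∈∁B) (x∈∁p⇒x∉p d∈∁B) b≢d bd)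
...   | no r≱3 =
  let e , e∈∁B , e≢b , e≢d = thirdElement (subst (3 ≤_) (sym (∣∁p∣≡n∸r {p = B} ∣B∣)) 3≤n∸r) b∈∁B d∈∁B b≢d in
  frame-split M ∣B∣ a∈B c∈B a≢c (x∈∁p⇒x∉p b∈∁B) (x∈∁p⇒x∉p e∈∁B) (≢-sym e≢b)
    (nonBasis-swapʳ M sp 2≤r (∣p-x-y∣≡r∸2 ∣B∣ a∈B c∈B a≢c) (∉p⇒∉p-x-y (x∈∁p⇒x∉p b∈∁B))
      (∉p⇒∉p-x-y (x∈∁p⇒x∉p d∈∁B)) (∉p⇒∉p-x-y (x∈∁p⇒x∉p e∈∁B)) b≢d (≢-sym e≢b) (≢-sym e≢d) bd)
  where
  3≤n∸r : 3 ≤ n ∸ r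
  3≤n∸r = m+n≤o⇒m≤o∸n 3 (≤-trans (+-monoʳ-≤ 3 (s≤s⁻¹ (≰⇒> r≱3))) 5≤n)

⊑⇒isBasis⊆ : ∀ (M₁ M₂ : Matroid n) → n ≥ 5 → 2 ≤ r → r ≤ n ∸ 2 → HasRank M₁ r → HasRank M₂ r →
             SparsePaving M₁ r → SparsePaving M₂ r → ν M₂ r ⊑[ r ] ν M₁ r →
             isBasis M₂ B ≡ true → isBasis M₁ B ≡ true
⊑⇒isBasis⊆ {B = B} M₁ M₂ 5≤n 2≤r r≤n∸2 hr₁ hr₂ sp₁ sp₂ ⊑ isB₂ with isBasis M₁ B in isB₁
... | true  = refl
... | false with frame {B = B} M₂ 5≤n 2≤r r≤n∸2 sp₂ (hr₂ B isB₂)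
...   | S , a , b , c , d , z , refl , bd₂ =
  ⊥-elim (⊑-excludes-frame M₁ M₂ 2≤r hr₁ hr₂ sp₁ sp₂ ⊑ z isB₁ isB₂ bd₂)

≡true⇔⇒≡ : ∀ {x y : Bool} → (x ≡ true → y ≡ true) → (y ≡ true → x ≡ true) → x ≡ y
≡true⇔⇒≡ {true}  x⇒y _   = sym (x⇒y refl)
≡true⇔⇒≡ {false} {true}  _ y⇒x = y⇒x refl
≡true⇔⇒≡ {false} {false} _ _   = refl

lemma14 : (n r : ℕ) (M₁ M₂ : Matroid n) →
          n ≥ 5 → 2 ≤ r → r ≤ n ∸ 2 →
          HasRank M₁ r → HasRank M₂ r →
          SparsePaving M₁ r → SparsePaving M₂ r →
          ((ν M₁ r) ∼[ r ] (ν M₂ r)) ⇔ SameMatroid M₁ M₂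
lemma14 n r M₁ M₂ 5≤n 2≤r r≤n∸2 hr₁ hr₂ sp₁ sp₂ = mk⇔ sameBases (≗⇒∼ {r = r} ∘ ν-cong M₁ M₂)
  where
  sameBases : ν M₁ r ∼[ r ] ν M₂ r → SameMatroid M₁ M₂
  sameBases ν₁∼ν₂ B = ≡true⇔⇒≡
    (⊑⇒isBasis⊆ M₂ M₁ 5≤n 2≤r r≤n∸2 hr₂ hr₁ sp₂ sp₁ λ S a b c d z → Equivalence.to (ν₁∼ν₂ S a b c d z))
    (⊑⇒isBasis⊆ M₁ M₂ 5≤n 2≤r r≤n∸2 hr₁ hr₂ sp₁ sp₂ λ S a b c d z → Equivalence.from (ν₁∼ν₂ S a b c d z))
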